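{- For every integer $n\ge 0$, let $L_n$ be the set of all subsets of $[n]=\{1,\ldots,n\}$ that are arithmetic progressions (including the empty set). Then $$|L_n|=1+n+\sum_{a=1}^{n-1}\sum_{r=1}^{a}\tau(r),$$ where $\tau(r)=\sum_{d\mid r}1$ is the number of positive divisors of $r$.
   Context: An arithmetic progression in $[n]$ is a set of the form $\{a,a+r,\ldots,a+(k-1)r\}\subseteq[n]$ with integers $a$, $r\ge1$, $k\ge0$; this includes the empty set, all singletons and all $2$-element subsets. For $n=0$, $L_0=\{\emptyset\}$. -}

module Defs where

open import Data.Nat using (ℕ; zero; suc; _+_; _*_; _∸_; _≤_; _<_)
open import Data.Nat.Divisibility using (_∣_; _∣?_)
open import Data.Fin using (Fin; toℕ)
open import Data.Fin.Subset using (Subset) renaming (_∈_ to _∈ₛ_)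
open import Data.List using (List; map; upTo; filter; length)
open import Data.Nat.ListAction using (sum)
open import Relation.Binary.PropositionalEquality using (_≡_)
open import Data.List.Membership.Propositional using () renaming (_∈_ to _∈ₗ_)
open import Data.List.Relation.Unary.Unique.Propositional using (Unique)
open import Data.Product using (Σ; ∃; _×_)
open import Function.Bundles using (_⇔_)

-- [n] = {1,…,n} is represented by Fin n, with i : Fin n standing for toℕ i + 1.
-- A subset of [n] is a Data.Fin.Subset n.

InAP : ℕ → ℕ → ℕ → ℕ → Set
InAP a r k x = ∃ λ j → j < k × x ≡ a + j * r

IsAP : (n : ℕ) → Subset n → Set
IsAP n s = Σ ℕ λ a → Σ ℕ λ r → Σ ℕ λ k →
  (1 ≤ r) ×
  ((j : ℕ) → j < k → (1 ≤ a + j * r) × (a + j * r ≤ n)) ×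
  ((i : Fin n) → (i ∈ₛ s) ⇔ InAP a r k (suc (toℕ i)))

CardL : ℕ → ℕ → Set
CardL n N = Σ (List (Subset n)) λ xs →
  Unique xs × ((s : Subset n) → (s ∈ₗ xs) ⇔ IsAP n s) × (length xs ≡ N)

sumFrom1 : ℕ → (ℕ → ℕ) → ℕ
sumFrom1 m f = sum (map (λ i → f (suc i)) (upTo m))

-- τ(r) = number of positive divisors of r (divisors of r > 0 lie in 1..r)
τ : ℕ → ℕ
τ r = length (filter (λ d → d ∣? r) (map suc (upTo r)))

{-# OPTIONS --safe #-}
-- Every arithmetic progression in [n] has exactly one canonical triple (first term a, step r,
-- length k): (1, 1, 0) for the empty set, (a, 1, 1) for a singleton, and for k ≥ 2 the set itself
-- determines the triple (a is its least element, a + r the next one, and then k is forced).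
-- So |L_n| counts canonical triples inside [n]. A triple with k ≥ 2 is determined by a, its span
-- D = (k - 1) r ∈ [1, n - a] and its step r ∣ D; for each a ∈ [1, n - 1] this gives
-- Σ_{D ≤ n - a} τ(D) progressions, whence the double sum.
module Submission where

open import Defs
open import Data.Nat using (ℕ; zero; suc; pred; _+_; _∸_; _*_; _≤_; _<_; z≤n; s≤s; s≤s⁻¹; _≟_)
open import Data.Nat.Properties
open import Data.Nat.DivMod using (_/_; m*n/n≡m)
open import Data.Nat.Divisibility using (_∣_; _∣?_; divides; ∣⇒≤)
open import Data.Nat.ListAction using (sum)
open import Data.Bool.Base using (Bool; true)
open import Data.Fin.Base using (Fin; toℕ; fromℕ<)
open import Data.Fin.Properties using (toℕ-fromℕ<)
open import Data.Fin.Subset using (Subset) renaming (_∈_ to _∈ₛ_)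
open import Data.Fin.Subset.Properties using (⊆-antisym)
open import Data.Vec.Base using (tabulate)
open import Data.Vec.Properties using ([]=⇒lookup; lookup⇒[]=; lookup∘tabulate)
open import Data.List.Base using (List; []; _∷_; map; upTo; filter; length; _++_; concatMap)
open import Data.List.Properties using (length-map; length-++; length-upTo; map-cong)
open import Data.List.Membership.Propositional using (find; lose) renaming (_∈_ to _∈ₗ_)
open import Data.List.Membership.Propositional.Properties
  using (∈-map⁺; ∈-map⁻; ∈-++⁺ˡ; ∈-++⁺ʳ; ∈-++⁻; ∈-concatMap⁺; ∈-concatMap⁻;
         ∈-upTo⁺; ∈-upTo⁻; ∈-filter⁺; ∈-filter⁻)
open import Data.List.Relation.Unary.Any using (here; there)
open import Data.List.Relation.Unary.All as All using ()
import Data.List.Relation.Unary.All.Properties as All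
open import Data.List.Relation.Unary.AllPairs using ([]; _∷_)
open import Data.List.Relation.Unary.Unique.Propositional using (Unique)
import Data.List.Relation.Unary.Unique.Propositional.Properties as Unique
open import Data.Product.Base using (∃; ∃₂; _×_; _,_; proj₁; proj₂)
open import Data.Sum.Base using (inj₁; inj₂)
open import Data.Empty using (⊥-elim)
open import Relation.Nullary using (Dec; yes; ¬_; does)
open import Relation.Nullary.Decidable using (dec-true)
open import Relation.Binary.PropositionalEquality
open import Function.Base using (_∘_)
open import Function.Bundles using (_⇔_; mk⇔; Equivalence)
import Function.Properties.Equivalence as ⇔
open Equivalence using (to; from)

private variable
  A B : Set
  a b n r s k k′ m x : ℕ

length-concatMap : ∀ (f : A → List B) xs → length (concatMap f xs) ≡ sum (map (length ∘ f) xs)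
length-concatMap f []       = refl
length-concatMap f (x ∷ xs) =
  trans (length-++ (f x)) (cong (length (f x) +_) (length-concatMap f xs))

map-unique : ∀ {f : A → B} {xs} → Unique xs →
             (∀ {x y} → x ∈ₗ xs → y ∈ₗ xs → f x ≡ f y → x ≡ y) → Unique (map f xs)
map-unique [] _ = []
map-unique (x∉xs ∷ xs!) f-inj =
  All.map⁺ (All.tabulate λ y∈xs fx≡fy → All.lookup x∉xs y∈xs (f-inj (here refl) (there y∈xs) fx≡fy))
  ∷ map-unique xs! (λ x∈ y∈ → f-inj (there x∈) (there y∈))

concatMap-unique : ∀ {f : A → List B} (tag : B → A) {xs} → Unique xs →
                   (∀ {x} → x ∈ₗ xs → Unique (f x)) →
                   (∀ {x y} → x ∈ₗ xs → y ∈ₗ f x → tag y ≡ x) →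
                   Unique (concatMap f xs)
concatMap-unique tag [] _ _ = []
concatMap-unique {f = f} tag {x ∷ xs} (x∉xs ∷ xs!) f! tagged =
  Unique.++⁺ (f! (here refl)) (concatMap-unique tag xs! (f! ∘ there) (tagged ∘ there)) disjoint
  where
  disjoint : ∀ {y} → ¬ (y ∈ₗ f x × y ∈ₗ concatMap f xs)
  disjoint (y∈fx , y∈rest) with find (∈-concatMap⁻ f {xs = xs} y∈rest)
  ... | x′ , x′∈xs , y∈fx′ =
    All.lookup x∉xs x′∈xs (trans (sym (tagged (here refl) y∈fx)) (tagged (there x′∈xs) y∈fx′))

Progression : Set
Progression = ℕ × ℕ × ℕ

infix 4 _∈ᴾ_ _∈ᴾ?_ _≋_

_∈ᴾ_ : ℕ → Progression → Set
x ∈ᴾ (a , r , k) = InAP a r k x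

_∈ᴾ?_ : (x : ℕ) (p : Progression) → Dec (x ∈ᴾ p)
x ∈ᴾ? (a , r , k) = anyUpTo? (λ j → x ≟ a + j * r) k

_≋_ : Progression → Progression → Set
p ≋ q = ∀ x → x ∈ᴾ p ⇔ x ∈ᴾ q

≋-sym : ∀ {p q} → p ≋ q → q ≋ p
≋-sym e x = ⇔.sym (e x)

Within : ℕ → Progression → Set
Within n (a , r , k) = (j : ℕ) → j < k → (1 ≤ a + j * r) × (a + j * r ≤ n)

head∈ : a ∈ᴾ (a , r , suc k)
head∈ {a} = 0 , s≤s z≤n , sym (+-identityʳ a)

second∈ : a + r ∈ᴾ (a , r , suc (suc k))
second∈ {a} {r} = 1 , s≤s (s≤s z≤n) , cong (a +_) (sym (*-identityˡ r))

∉-empty : ¬ (x ∈ᴾ (a , r , 0))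
∉-empty (_ , () , _)

∈-singleton⁻ : x ∈ᴾ (a , r , 1) → x ≡ a
∈-singleton⁻ {a = a} (zero , _ , x≡a+0) = trans x≡a+0 (+-identityʳ a)
∈-singleton⁻ (suc _ , s≤s () , _)

empty-≋ : (a , r , 0) ≋ (b , s , 0)
empty-≋ _ = mk⇔ (⊥-elim ∘ ∉-empty) (⊥-elim ∘ ∉-empty)

singleton-≋ : (a , r , 1) ≋ (a , s , 1)
singleton-≋ {a} x = mk⇔ restep restep
  where
  restep : ∀ {r s} → x ∈ᴾ (a , r , 1) → x ∈ᴾ (a , s , 1)
  restep (zero , 0<1 , x≡a+0) = zero , 0<1 , x≡a+0
  restep (suc _ , s≤s () , _)

head≤ : x ∈ᴾ (a , r , k) → a ≤ x
head≤ {a = a} {r} (j , _ , refl) = m≤m+n a (j * r)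

∈⇒index< : a + m * suc r ∈ᴾ (a , suc r , k) → m < k
∈⇒index< {a} {m} {r} (j , j<k , eq) =
  subst (_< _) (sym (*-cancelʳ-≡ m j (suc r) (+-cancelˡ-≡ a _ _ eq))) j<k

∈⇒step≤ : a + suc r ∈ᴾ (a , suc s , k) → s ≤ r
∈⇒step≤ {a} (zero , _ , eq) = ⊥-elim (1+n≢0 (+-cancelˡ-≡ a _ 0 eq))
∈⇒step≤ {a} {r} {s} (suc j , _ , eq) =
  s≤s⁻¹ (subst (suc s ≤_) (sym (+-cancelˡ-≡ a _ _ eq)) (m≤m+n (suc s) (j * suc s)))

≋-head : (a , r , suc k) ≋ (b , s , suc k′) → a ≡ b
≋-head e = ≤-antisym (head≤ (from (e _) head∈)) (head≤ (to (e _) head∈))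

≋-step : (a , suc r , suc (suc k)) ≋ (a , suc s , suc (suc k′)) → r ≡ s
≋-step e = ≤-antisym (∈⇒step≤ (from (e _) second∈)) (∈⇒step≤ (to (e _) second∈))

⊆⇒length≤ : (∀ {x} → x ∈ᴾ (a , suc r , k) → x ∈ᴾ (a , suc r , k′)) → k ≤ k′
⊆⇒length≤ {k = zero}  _   = z≤n
⊆⇒length≤ {k = suc k} sub = ∈⇒index< (sub (k , ≤-refl , refl))

≋-length : (a , suc r , k) ≋ (a , suc r , k′) → k ≡ k′
≋-length e = ≤-antisym (⊆⇒length≤ (to (e _))) (⊆⇒length≤ (from (e _)))

data Canonical : Progression → Set where
  empty     : Canonical (1 , 1 , 0)
  singleton : Canonical (a , 1 , 1)
  long      : Canonical (a , suc r , suc (suc m))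

canonical-step-positive : Canonical (a , r , k) → 1 ≤ r
canonical-step-positive empty     = s≤s z≤n
canonical-step-positive singleton = s≤s z≤n
canonical-step-positive long      = s≤s z≤n

canonicalise : ∀ a r k → 1 ≤ r → ∃ λ q → Canonical q × (a , r , k) ≋ q
canonicalise a r       zero          _  = _ , empty , empty-≋
canonicalise a r       (suc zero)    _  = _ , singleton , singleton-≋
canonicalise a zero    (suc (suc k)) ()
canonicalise a (suc r) (suc (suc k)) _  = _ , long , λ _ → ⇔.refl

canonical-unique : ∀ {p q} → Canonical p → Canonical q → p ≋ q → p ≡ q
canonical-unique empty     empty     _ = refl
canonical-unique empty     singleton e = ⊥-elim (∉-empty (from (e _) head∈))
canonical-unique empty     long      e = ⊥-elim (∉-empty (from (e _) head∈))
canonical-unique singleton empty     e = sym (canonical-unique empty singleton (≋-sym e))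
canonical-unique long      empty     e = sym (canonical-unique empty long (≋-sym e))
canonical-unique singleton singleton e = cong (λ a → a , 1 , 1) (≋-head e)
canonical-unique singleton long      e with ≋-head e
... | refl = ⊥-elim (m+1+n≢m _ (∈-singleton⁻ (from (e _) second∈)))
canonical-unique long      singleton e = sym (canonical-unique singleton long (≋-sym e))
canonical-unique (long {a} {r}) long e with ≋-head e
... | refl with ≋-step e
... | refl = cong (λ k → a , suc r , k) (≋-length e)

within⇒bounds : ∀ {p} → Within n p → x ∈ᴾ p → 1 ≤ x × x ≤ n
within⇒bounds w (j , j<k , refl) = w j j<k

within-resp-≋ : ∀ {p q} → p ≋ q → Within n p → Within n q
within-resp-≋ e w j j<k = within⇒bounds w (from (e _) (j , j<k , refl))

ends⇒within : 1 ≤ a → a + k * r ≤ n → Within n (a , r , suc k)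
ends⇒within {a} {k} {r} 1≤a last≤n j j<1+k =
  ≤-trans 1≤a (m≤m+n a (j * r)) ,
  ≤-trans (+-monoʳ-≤ a (*-monoˡ-≤ r (s≤s⁻¹ j<1+k))) last≤n

within⇒ends : Within n (a , r , suc k) → 1 ≤ a × a + k * r ≤ n
within⇒ends {a = a} w =
  subst (1 ≤_) (+-identityʳ a) (proj₁ (w 0 (s≤s z≤n))) , proj₂ (w _ ≤-refl)

subsetOf : (n : ℕ) → Progression → Subset n
subsetOf n p = tabulate (λ i → does (suc (toℕ i) ∈ᴾ? p))

∈-subsetOf : ∀ p (i : Fin n) → i ∈ₛ subsetOf n p ⇔ suc (toℕ i) ∈ᴾ p
∈-subsetOf {n} p i = mk⇔
  (λ i∈ → does-true (suc (toℕ i) ∈ᴾ? p) (trans (sym (lookup∘tabulate member i)) ([]=⇒lookup i∈)))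
  (λ x∈ → lookup⇒[]= i _ (trans (lookup∘tabulate member i) (dec-true (_ ∈ᴾ? p) x∈)))
  where
  member : Fin n → Bool
  member i = does (suc (toℕ i) ∈ᴾ? p)
  does-true : ∀ {P : Set} (P? : Dec P) → does P? ≡ true → P
  does-true (yes p) _ = p

∈-subsetOf-fromℕ< : ∀ p {y} (y<n : y < n) → fromℕ< y<n ∈ₛ subsetOf n p ⇔ suc y ∈ᴾ p
∈-subsetOf-fromℕ< {n} p y<n =
  subst (λ z → fromℕ< y<n ∈ₛ subsetOf n p ⇔ suc z ∈ᴾ p) (toℕ-fromℕ< y<n)
    (∈-subsetOf p (fromℕ< y<n))

subsetOf-≡⇒⊆ : ∀ {p q} → Within n p → subsetOf n p ≡ subsetOf n q → x ∈ᴾ p → x ∈ᴾ q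
subsetOf-≡⇒⊆ {x = zero} w _ x∈p with () ← proj₁ (within⇒bounds w x∈p)
subsetOf-≡⇒⊆ {n} {suc y} {p} {q} w eq x∈p =
  to (∈-subsetOf-fromℕ< q y<n) (subst (fromℕ< y<n ∈ₛ_) eq (from (∈-subsetOf-fromℕ< p y<n) x∈p))
  where
  y<n : y < n
  y<n = proj₂ (within⇒bounds w x∈p)

subsetOf-injective : ∀ {p q} → Canonical p → Canonical q → Within n p → Within n q →
                     subsetOf n p ≡ subsetOf n q → p ≡ q
subsetOf-injective cp cq wp wq eq =
  canonical-unique cp cq λ _ → mk⇔ (subsetOf-≡⇒⊆ wp eq) (subsetOf-≡⇒⊆ wq (sym eq))

subsetOf-isAP : ∀ {p} → Canonical p → Within n p → IsAP n (subsetOf n p)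
subsetOf-isAP {p = a , r , k} c w = a , r , k , canonical-step-positive c , w , ∈-subsetOf (a , r , k)

isAP⇒subsetOf : ∀ {s} → IsAP n s → ∃ λ q → Canonical q × Within n q × s ≡ subsetOf n q
isAP⇒subsetOf {n} {s} (a , r , k , 1≤r , w , s-members) with canonicalise a r k 1≤r
... | q , c , e = q , c , within-resp-≋ e w ,
  ⊆-antisym (λ {i} i∈s → from (∈-subsetOf q i) (to (e _) (to (s-members i) i∈s)))
            (λ {i} i∈q → from (s-members i) (from (e _) (to (∈-subsetOf q i) i∈q)))

divisors : ℕ → List ℕ
divisors D = filter (_∣? D) (map suc (upTo D))

∈-divisors⁻ : ∀ {d D} → d ∈ₗ divisors D → ∃ λ r → d ≡ suc r × suc r ∣ D
∈-divisors⁻ {D = D} d∈ with ∈-filter⁻ (_∣? D) {xs = map suc (upTo D)} d∈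
... | d∈′ , d∣D with ∈-map⁻ suc d∈′
... | r , _ , refl = r , refl , d∣D

∈-divisors⁺ : ∀ {r D} → suc r ∣ suc D → suc r ∈ₗ divisors (suc D)
∈-divisors⁺ {D = D} d∣D = ∈-filter⁺ (_∣? suc D) (∈-map⁺ suc (∈-upTo⁺ (∣⇒≤ d∣D))) d∣D

-- The clause for step 0 is never used: divisors are positive.
withStep : ℕ → ℕ → ℕ → Progression
withStep a D zero    = a , 1 , 0
withStep a D (suc r) = a , suc r , suc (D / suc r)

withStep-injective : withStep a b r ≡ withStep a b s → r ≡ s
withStep-injective {r = zero}  {s = zero}  _  = refl
withStep-injective {r = zero}  {s = suc s} ()
withStep-injective {r = suc r} {s = zero}  ()
withStep-injective {r = suc r} {s = suc s} eq = cong (proj₁ ∘ proj₂) eq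

withSpan : ℕ → ℕ → List Progression
withSpan a D = map (withStep a D) (divisors D)

∈-withSpan⁻ : ∀ {p j} → p ∈ₗ withSpan a (suc j) →
              ∃₂ λ r m → p ≡ (a , suc r , suc (suc m)) × suc m * suc r ≡ suc j
∈-withSpan⁻ {a} {j = j} p∈ with ∈-map⁻ (withStep a (suc j)) p∈
... | d , d∈ , refl with ∈-divisors⁻ {D = suc j} d∈
... | r , refl , divides (suc m) eq =
  r , m , cong (λ q → a , suc r , suc q) (trans (cong (_/ suc r) eq) (m*n/n≡m (suc m) (suc r))) ,
  sym eq

∈-withSpan⁺ : (a , suc r , suc (suc m)) ∈ₗ withSpan a (suc m * suc r)
∈-withSpan⁺ {a} {r} {m} =
  subst (_∈ₗ withSpan a (suc m * suc r)) (cong (λ q → a , suc r , suc q) (m*n/n≡m (suc m) (suc r)))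
    (∈-map⁺ (withStep a (suc m * suc r)) (∈-divisors⁺ (divides (suc m) refl)))

withSpan-unique : ∀ a D → Unique (withSpan a D)
withSpan-unique a D =
  Unique.map⁺ withStep-injective (Unique.filter⁺ (_∣? D) (Unique.map⁺ suc-injective (Unique.upTo⁺ D)))

longsFrom : ℕ → ℕ → List Progression
longsFrom a w = concatMap (λ j → withSpan a (suc j)) (upTo w)

∈-longsFrom⁻ : ∀ {p w} → p ∈ₗ longsFrom a w →
               ∃₂ λ r m → p ≡ (a , suc r , suc (suc m)) × suc m * suc r ≤ w
∈-longsFrom⁻ {a} {w = w} p∈
  with find (∈-concatMap⁻ (λ j → withSpan a (suc j)) {xs = upTo w} p∈)
... | j , j∈ , p∈′ with ∈-withSpan⁻ p∈′
... | r , m , refl , span≡ = r , m , refl , subst (_≤ w) (sym span≡) (∈-upTo⁻ j∈)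

∈-longsFrom⁺ : ∀ {w} → suc m * suc r ≤ w → (a , suc r , suc (suc m)) ∈ₗ longsFrom a w
∈-longsFrom⁺ {a = a} span≤w =
  ∈-concatMap⁺ (λ j → withSpan a (suc j)) (lose (∈-upTo⁺ span≤w) ∈-withSpan⁺)

longs : ℕ → List Progression
longs n = concatMap (λ i → longsFrom (n ∸ suc i) (suc i)) (upTo (n ∸ 1))

<∸1⇒1+< : ∀ {i} n → i < n ∸ 1 → suc i < n
<∸1⇒1+< (suc n) i<n = s≤s i<n

data LongWithin (n : ℕ) : Progression → Set where
  longWithin : 1 ≤ a → a + suc m * suc r ≤ n → LongWithin n (a , suc r , suc (suc m))

∈-longs⁻ : ∀ n {p} → p ∈ₗ longs n → LongWithin n p
∈-longs⁻ n p∈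
  with find (∈-concatMap⁻ (λ i → longsFrom (n ∸ suc i) (suc i)) {xs = upTo (n ∸ 1)} p∈)
... | i , i∈ , p∈′ with ∈-longsFrom⁻ {w = suc i} p∈′
... | r , m , refl , span≤ =
  longWithin (m<n⇒0<n∸m 1+i<n)
    (≤-trans (+-monoʳ-≤ (n ∸ suc i) span≤) (≤-reflexive (m∸n+n≡m (<⇒≤ 1+i<n))))
  where
  1+i<n : suc i < n
  1+i<n = <∸1⇒1+< n (∈-upTo⁻ i∈)

∈-longs⁺ : ∀ {p} → LongWithin n p → p ∈ₗ longs n
∈-longs⁺ {n} (longWithin {a} {m} {r} 1≤a last≤n) =
  from-block 1≤a n≡ (∈-longsFrom⁺ (m≤m+n (suc m * suc r) slack))
  where
  slack : ℕ
  slack = n ∸ (a + suc m * suc r)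
  n≡ : a + (suc m * suc r + slack) ≡ n
  n≡ = trans (sym (+-assoc a _ slack)) (m+[n∸m]≡n last≤n)
  from-block : ∀ {p a i n} → 1 ≤ a → a + suc i ≡ n → p ∈ₗ longsFrom a (suc i) → p ∈ₗ longs n
  from-block {p} {suc a} {i} {n} _ refl p∈ =
    ∈-concatMap⁺ (λ j → longsFrom (n ∸ suc j) (suc j)) (lose (∈-upTo⁺ (m≤n+m (suc i) a)) p∈′)
    where
    p∈′ : p ∈ₗ longsFrom (n ∸ suc i) (suc i)
    p∈′ = subst (λ b → p ∈ₗ longsFrom b (suc i)) (sym (m+n∸n≡m (suc a) (suc i))) p∈

span : Progression → ℕ
span (_ , r , k) = (k ∸ 1) * r

longsFrom-unique : ∀ a w → Unique (longsFrom a w)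
longsFrom-unique a w = concatMap-unique (pred ∘ span) (Unique.upTo⁺ w)
  (λ {j} _ → withSpan-unique a (suc j)) tagged
  where
  tagged : ∀ {j p} → j ∈ₗ upTo w → p ∈ₗ withSpan a (suc j) → pred (span p) ≡ j
  tagged _ p∈ with ∈-withSpan⁻ p∈
  ... | _ , _ , refl , span≡ = cong pred span≡

longs-unique : ∀ n → Unique (longs n)
longs-unique n = concatMap-unique (λ p → pred (n ∸ proj₁ p)) (Unique.upTo⁺ (n ∸ 1))
  (λ {i} _ → longsFrom-unique (n ∸ suc i) (suc i)) tagged
  where
  tagged : ∀ {i p} → i ∈ₗ upTo (n ∸ 1) → p ∈ₗ longsFrom (n ∸ suc i) (suc i) →
           pred (n ∸ proj₁ p) ≡ i
  tagged {i} i∈ p∈ with ∈-longsFrom⁻ {w = suc i} p∈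
  ... | _ , _ , refl , _ = cong pred (m∸[m∸n]≡n (<⇒≤ (<∸1⇒1+< n (∈-upTo⁻ i∈))))

singletonAt : ℕ → Progression
singletonAt i = suc i , 1 , 1

singletons : ℕ → List Progression
singletons n = map singletonAt (upTo n)

canonicals : ℕ → List Progression
canonicals n = (1 , 1 , 0) ∷ singletons n ++ longs n

∈-canonicals⁻ : ∀ {p} → p ∈ₗ canonicals n → Canonical p × Within n p
∈-canonicals⁻ (here refl) = empty , λ _ ()
∈-canonicals⁻ {n} (there p∈) with ∈-++⁻ (singletons n) p∈
... | inj₁ p∈singletons with ∈-map⁻ singletonAt p∈singletons
...   | i , i∈ , refl =
  singleton , ends⇒within (s≤s z≤n) (subst (_≤ n) (sym (+-identityʳ (suc i))) (∈-upTo⁻ i∈))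
∈-canonicals⁻ {n} (there p∈) | inj₂ p∈longs with ∈-longs⁻ n p∈longs
...   | longWithin 1≤a last≤n = long , ends⇒within 1≤a last≤n

∈-canonicals⁺ : ∀ {p} → Canonical p → Within n p → p ∈ₗ canonicals n
∈-canonicals⁺ empty _ = here refl
∈-canonicals⁺ {n} (singleton {a}) w with within⇒ends w
... | 1≤a , a+0≤n with a
...   | suc i =
  there (∈-++⁺ˡ (∈-map⁺ singletonAt (∈-upTo⁺ (subst (_≤ n) (+-identityʳ (suc i)) a+0≤n))))
∈-canonicals⁺ {n} long w with within⇒ends w
... | 1≤a , last≤n = there (∈-++⁺ʳ (singletons n) (∈-longs⁺ (longWithin 1≤a last≤n)))

canonicals-unique : ∀ n → Unique (canonicals n)
canonicals-unique n =
  All.tabulate empty-fresh ∷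
  Unique.++⁺ (Unique.map⁺ (suc-injective ∘ cong proj₁) (Unique.upTo⁺ n)) (longs-unique n) disjoint
  where
  empty-fresh : ∀ {p} → p ∈ₗ singletons n ++ longs n → (1 , 1 , 0) ≢ p
  empty-fresh p∈ with ∈-++⁻ (singletons n) p∈
  ... | inj₁ p∈singletons with ∈-map⁻ singletonAt p∈singletons
  ...   | _ , _ , refl = λ ()
  empty-fresh p∈ | inj₂ p∈longs with ∈-longs⁻ n p∈longs
  ...   | longWithin _ _ = λ ()
  disjoint : ∀ {p} → ¬ (p ∈ₗ singletons n × p ∈ₗ longs n)
  disjoint (p∈singletons , p∈longs)
    with ∈-map⁻ singletonAt p∈singletons | ∈-longs⁻ n p∈longs
  ... | _ , _ , refl | ()

length-longsFrom : ∀ a w → length (longsFrom a w) ≡ sumFrom1 w τ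
length-longsFrom a w = trans (length-concatMap (λ j → withSpan a (suc j)) (upTo w))
  (cong sum (map-cong (λ j → length-map (withStep a (suc j)) (divisors (suc j))) (upTo w)))

length-longs : ∀ n → length (longs n) ≡ sumFrom1 (n ∸ 1) (λ a → sumFrom1 a τ)
length-longs n = trans (length-concatMap (λ i → longsFrom (n ∸ suc i) (suc i)) (upTo (n ∸ 1)))
  (cong sum (map-cong (λ i → length-longsFrom (n ∸ suc i) (suc i)) (upTo (n ∸ 1))))

length-canonicals : ∀ n → length (canonicals n) ≡ 1 + n + sumFrom1 (n ∸ 1) (λ a → sumFrom1 a τ)
length-canonicals n = begin
  1 + length (singletons n ++ longs n)
    ≡⟨ cong suc (length-++ (singletons n)) ⟩
  1 + (length (singletons n) + length (longs n))
    ≡⟨ cong₂ (λ s l → 1 + (s + l)) length-singletons (length-longs n) ⟩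
  1 + n + sumFrom1 (n ∸ 1) (λ a → sumFrom1 a τ)
    ∎
  where
  open ≡-Reasoning
  length-singletons : length (singletons n) ≡ n
  length-singletons = trans (length-map singletonAt (upTo n)) (length-upTo n)

apSubsets : (n : ℕ) → List (Subset n)
apSubsets n = map (subsetOf n) (canonicals n)

apSubsets-unique : ∀ n → Unique (apSubsets n)
apSubsets-unique n = map-unique (canonicals-unique n) λ p∈ q∈ →
  let cp , wp = ∈-canonicals⁻ p∈; cq , wq = ∈-canonicals⁻ q∈ in subsetOf-injective cp cq wp wq

∈-apSubsets⇔isAP : ∀ s → s ∈ₗ apSubsets n ⇔ IsAP n s
∈-apSubsets⇔isAP {n} s = mk⇔ sound complete
  where
  sound : s ∈ₗ apSubsets n → IsAP n s
  sound s∈ with ∈-map⁻ (subsetOf n) s∈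
  ... | p , p∈ , refl = let c , w = ∈-canonicals⁻ p∈ in subsetOf-isAP c w
  complete : IsAP n s → s ∈ₗ apSubsets n
  complete ap with isAP⇒subsetOf ap
  ... | q , c , w , refl = ∈-map⁺ (subsetOf n) (∈-canonicals⁺ c w)

corollary3 : (n : ℕ) →
    CardL n (1 + n + sumFrom1 (n ∸ 1) (λ a → sumFrom1 a τ))
corollary3 n =
  apSubsets n , apSubsets-unique n , ∈-apSubsets⇔isAP ,
  trans (length-map (subsetOf n) (canonicals n)) (length-canonicals n)
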